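{- Let $a,b,n$ be positive integers with $2\leq a<b$, $a\equiv b\pmod 2$, $na$ even, and $n\geq 2a+1$. Then the graph $G_n^a$ has no parity $[a,b]$-factor.
   Context: A parity $[a,b]$-factor of a graph $G$ is a spanning subgraph $H$ such that for every vertex $v$, $a\leq d_H(v)\leq b$ and $d_H(v)\equiv a\equiv b\pmod 2$. The graph $G_n^a$ is obtained from $K_{a-1}\vee(K_{n-2a-1}\cup (a+1)K_1)$ (where $\vee$ is the join, $\cup$ the disjoint union, $K_m$ the complete graph on $m$ vertices, $(a+1)K_1$ the edgeless graph on $a+1$ vertices) by adding one new vertex adjacent exactly to the $a+1$ vertices of $(a+1)K_1$; it has $n$ vertices. -}

module Defs where

open import Data.Nat using (ℕ; zero; suc; _+_; _∸_; _<ᵇ_; _%_; _≤_)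
open import Data.Fin using (Fin; zero; suc; toℕ)
open import Data.Bool using (Bool; true; false; if_then_else_; _∧_; not)
open import Data.Product using (Σ-syntax; _×_)
open import Relation.Binary.PropositionalEquality using (_≡_)

record Graph (n : ℕ) : Set where
  field
    adj    : Fin n → Fin n → Bool
    sym    : ∀ i j → adj i j ≡ adj j i
    irrefl : ∀ i → adj i i ≡ false
open Graph public

countTrue : ∀ {n} → (Fin n → Bool) → ℕ
countTrue {zero}  f = 0
countTrue {suc n} f = (if f zero then 1 else 0) + countTrue (λ j → f (suc j))

deg : ∀ {n} → Graph n → Fin n → ℕ
deg G v = countTrue (adj G v)

SpanningSubgraph : ∀ {n} → Graph n → Graph n → Set
SpanningSubgraph {n} H G = ∀ (i j : Fin n) → adj H i j ≡ true → adj G i j ≡ true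

IsParityFactor : ∀ {n} → ℕ → ℕ → Graph n → Graph n → Set
IsParityFactor {n} a b G H =
  SpanningSubgraph H G ×
  (∀ (v : Fin n) → a ≤ deg H v × deg H v ≤ b × deg H v % 2 ≡ a % 2)

HasParityFactor : ∀ {n} → ℕ → ℕ → Graph n → Set
HasParityFactor {n} a b G = Σ[ H ∈ Graph n ] IsParityFactor a b G H

-- Vertex labels (by toℕ):
--   [0, a-1)          : clique K_{a-1}           (class cA)
--   [a-1, n-a-2)      : clique K_{n-2a-1}        (class cB)
--   [n-a-2, n-1)      : independent set (a+1)K_1 (class cI)
--   n-1               : the new vertex           (class cW)
data Cls : Set where
  cA cB cI cW : Cls

cls : ℕ → ℕ → ℕ → Cls
cls a n k =
  if k <ᵇ (a ∸ 1) then cA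
  else if k <ᵇ (n ∸ (a + 2)) then cB
  else if k <ᵇ (n ∸ 1) then cI
  else cW

clsAdj : Cls → Cls → Bool
clsAdj cA cA = true
clsAdj cA cB = true
clsAdj cA cI = true
clsAdj cB cA = true
clsAdj cB cB = true
clsAdj cI cA = true
clsAdj cI cW = true
clsAdj cW cI = true
clsAdj _  _  = false

clsAdj-sym : ∀ x y → clsAdj x y ≡ clsAdj y x
clsAdj-sym cA cA = _≡_.refl
clsAdj-sym cA cB = _≡_.refl
clsAdj-sym cA cI = _≡_.refl
clsAdj-sym cA cW = _≡_.refl
clsAdj-sym cB cA = _≡_.refl
clsAdj-sym cB cB = _≡_.refl
clsAdj-sym cB cI = _≡_.refl
clsAdj-sym cB cW = _≡_.refl
clsAdj-sym cI cA = _≡_.refl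
clsAdj-sym cI cB = _≡_.refl
clsAdj-sym cI cI = _≡_.refl
clsAdj-sym cI cW = _≡_.refl
clsAdj-sym cW cA = _≡_.refl
clsAdj-sym cW cB = _≡_.refl
clsAdj-sym cW cI = _≡_.refl
clsAdj-sym cW cW = _≡_.refl

open import Data.Nat using (_≡ᵇ_)
open import Data.Bool.Properties using (∧-comm)
open import Relation.Binary.PropositionalEquality using (cong₂; trans; cong)

≡ᵇ-refl : ∀ m → (m ≡ᵇ m) ≡ true
≡ᵇ-refl zero = _≡_.refl
≡ᵇ-refl (suc m) = ≡ᵇ-refl m

≡ᵇ-sym : ∀ m k → (m ≡ᵇ k) ≡ (k ≡ᵇ m)
≡ᵇ-sym zero zero = _≡_.refl
≡ᵇ-sym zero (suc k) = _≡_.refl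
≡ᵇ-sym (suc m) zero = _≡_.refl
≡ᵇ-sym (suc m) (suc k) = ≡ᵇ-sym m k

Gna : (n a : ℕ) → Graph n
Gna n a = record
  { adj    = λ i j → not (toℕ i ≡ᵇ toℕ j) ∧ clsAdj (cls a n (toℕ i)) (cls a n (toℕ j))
  ; sym    = λ i j → cong₂ _∧_ (cong not (≡ᵇ-sym (toℕ i) (toℕ j)))
                               (clsAdj-sym (cls a n (toℕ i)) (cls a n (toℕ j)))
  ; irrefl = λ i → cong (λ z → not z ∧ clsAdj (cls a n (toℕ i)) (cls a n (toℕ i))) (≡ᵇ-refl (toℕ i))
  }

module Submission where

-- The new vertex w of G_n^a has exactly a + 1 neighbours, the vertices of (a+1)K_1, and
-- each of them has degree exactly a. In a parity [a,b]-factor H every vertex keeps at least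
-- a edges, so these neighbours keep all their edges, in particular the one to w. Hence
-- d_H(w) = a + 1, which has the wrong parity.

open import Defs
open import Data.Nat using (ℕ; zero; suc; _+_; _*_; _∸_; _%_; _≤_; _<_; _<ᵇ_; _≡ᵇ_; z≤n; s≤s; >-nonZero)
open import Data.Nat.Properties
open import Data.Fin using (Fin; zero; suc; toℕ; fromℕ)
open import Data.Fin.Properties using (toℕ-fromℕ)
open import Data.Bool using (Bool; true; false; if_then_else_; _∧_; not)
open import Data.Bool.Properties using (∧-conicalʳ)
open import Data.Product using (_,_; proj₁; proj₂)
open import Data.Empty using (⊥-elim)
open import Relation.Nullary using (¬_)
open import Relation.Nullary.Reflects using (ofʸ; ofⁿ)
open import Relation.Binary.PropositionalEquality using (_≡_; _≢_; refl; trans; cong; cong₂; subst)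
import Relation.Binary.PropositionalEquality as ≡

count : (ℕ → Bool) → ℕ → ℕ
count g zero    = 0
count g (suc n) = (if g 0 then 1 else 0) + count (λ k → g (suc k)) n

countTrue-toℕ : ∀ n (g : ℕ → Bool) → countTrue {n} (λ j → g (toℕ j)) ≡ count g n
countTrue-toℕ zero    g = refl
countTrue-toℕ (suc n) g = cong ((if g 0 then 1 else 0) +_) (countTrue-toℕ n (λ k → g (suc k)))

count-cong : ∀ n {f g : ℕ → Bool} → (∀ k → f k ≡ g k) → count f n ≡ count g n
count-cong zero    f≗g = refl
count-cong (suc n) f≗g =
  cong₂ _+_ (cong (λ b → if b then 1 else 0) (f≗g 0)) (count-cong n (λ k → f≗g (suc k)))

count-punctured : ∀ {i} n (g : ℕ → Bool) → g i ≡ false →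
  count (λ k → not (i ≡ᵇ k) ∧ g k) n ≡ count g n
count-punctured         zero    g gi = refl
count-punctured {zero}  (suc n) g gi rewrite gi = refl
count-punctured {suc i} (suc n) g gi =
  cong ((if g 0 then 1 else 0) +_) (count-punctured n (λ k → g (suc k)) gi)

count-not+count : ∀ n (g : ℕ → Bool) → count (λ k → not (g k)) n + count g n ≡ n
count-not+count zero    g = refl
count-not+count (suc n) g with g 0
... | true  = trans (+-suc _ _) (cong suc (count-not+count n (λ k → g (suc k))))
... | false = cong suc (count-not+count n (λ k → g (suc k)))

count-not : ∀ n (g : ℕ → Bool) → count (λ k → not (g k)) n ≡ n ∸ count g n
count-not n g =
  trans (≡.sym (m+n∸n≡m _ (count g n))) (cong (_∸ count g n) (count-not+count n g))

count-<ᵇ : ∀ {u n} → u ≤ n → count (_<ᵇ u) n ≡ u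
count-<ᵇ {zero}  {zero}  z≤n       = refl
count-<ᵇ {zero}  {suc n} z≤n       = count-<ᵇ {zero} {n} z≤n
count-<ᵇ {suc u} {suc n} (s≤s u≤n) = cong suc (count-<ᵇ u≤n)

between : ℕ → ℕ → ℕ → Bool
between l u k = not (k <ᵇ l) ∧ (k <ᵇ u)

count-between : ∀ {l u n} → l ≤ u → u ≤ n → count (between l u) n ≡ u ∸ l
count-between {zero}                    _         u≤n       = count-<ᵇ u≤n
count-between {suc l} {suc u} {suc n} (s≤s l≤u) (s≤s u≤n) = count-between l≤u u≤n

countTrue-mono : ∀ {n} {f g : Fin n → Bool} → (∀ j → f j ≡ true → g j ≡ true) →
  countTrue f ≤ countTrue g
countTrue-mono {zero}          f⇒g = z≤n
countTrue-mono {suc n} {f} {g} f⇒g with f zero in f0 | g zero in g0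
... | true  | true  = s≤s (countTrue-mono (λ j → f⇒g (suc j)))
... | true  | false with () ← trans (≡.sym (f⇒g zero f0)) g0
... | false | true  = m≤n⇒m≤1+n (countTrue-mono (λ j → f⇒g (suc j)))
... | false | false = countTrue-mono (λ j → f⇒g (suc j))

countTrue-mono-< : ∀ {n} {f g : Fin n → Bool} → (∀ j → f j ≡ true → g j ≡ true) →
  ∀ i → f i ≡ false → g i ≡ true → countTrue f < countTrue g
countTrue-mono-< {suc n} {f} {g} f⇒g zero    fi gi rewrite fi | gi =
  s≤s (countTrue-mono (λ j → f⇒g (suc j)))
countTrue-mono-< {suc n} {f} {g} f⇒g (suc i) fi gi with f zero in f0 | g zero in g0
... | true  | true  = s≤s (countTrue-mono-< (λ j → f⇒g (suc j)) i fi gi)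
... | true  | false with () ← trans (≡.sym (f⇒g zero f0)) g0
... | false | true  = m≤n⇒m≤1+n (countTrue-mono-< (λ j → f⇒g (suc j)) i fi gi)
... | false | false = countTrue-mono-< (λ j → f⇒g (suc j)) i fi gi

module _ {n} {G H : Graph n} (H⊆G : SpanningSubgraph H G) where

  deg-spanningSubgraph : ∀ v → deg H v ≤ deg G v
  deg-spanningSubgraph v = countTrue-mono (H⊆G v)

  edge-at-saturated : ∀ {v u} → deg G v ≤ deg H v → adj G v u ≡ true → adj H v u ≡ true
  edge-at-saturated {v} {u} saturated vu with adj H v u in vu∉H
  ... | true  = refl
  ... | false = ⊥-elim (<⇒≱ (countTrue-mono-< (H⊆G v) u vu∉H vu) saturated)

  deg-if-neighbours-saturated : ∀ w → (∀ u → adj G w u ≡ true → deg G u ≤ deg H u) →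
    deg G w ≡ deg H w
  deg-if-neighbours-saturated w saturated =
    ≤-antisym (countTrue-mono wu⇒wu∈H) (deg-spanningSubgraph w)
    where
    wu⇒wu∈H : ∀ u → adj G w u ≡ true → adj H w u ≡ true
    wu⇒wu∈H u wu = trans (sym H w u) (edge-at-saturated (saturated u wu) (trans (sym G u w) wu))

no-parity-factor : ∀ {n} {G : Graph n} a b (w : Fin n) →
  (∀ u → adj G w u ≡ true → deg G u ≤ a) → deg G w % 2 ≢ a % 2 → ¬ HasParityFactor a b G
no-parity-factor {G = G} a b w small wrong-parity (H , H⊆G , degH) =
  wrong-parity (trans (cong (_% 2) degG≡degH) (proj₂ (proj₂ (degH w))))
  where
  degG≡degH : deg G w ≡ deg H w
  degG≡degH = deg-if-neighbours-saturated {G = G} {H = H} H⊆G w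
    (λ u wu → ≤-trans (small u wu) (proj₁ (degH u)))

-- A = a ∸ 1, C = n ∸ (a + 2) and M = n ∸ 1 are the boundaries of the vertex classes of cls.
module _ (a n : ℕ) where

  n∸[a+2]≤n∸1 : n ∸ (a + 2) ≤ n ∸ 1
  n∸[a+2]≤n∸1 = ∸-monoʳ-≤ n (≤-trans (n≤1+n 1) (m≤n+m 2 a))

  cls-≥n∸1 : a ∸ 1 ≤ n ∸ (a + 2) → ∀ k → n ∸ 1 ≤ k → cls a n k ≡ cW
  cls-≥n∸1 A≤C k M≤k
    with k <ᵇ (a ∸ 1) | <ᵇ-reflects-< k (a ∸ 1) | k <ᵇ (n ∸ (a + 2)) | <ᵇ-reflects-< k (n ∸ (a + 2))
       | k <ᵇ (n ∸ 1) | <ᵇ-reflects-< k (n ∸ 1)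
  ... | true  | ofʸ k<A | _     | _       | _     | _       =
    ⊥-elim (<⇒≱ k<A (≤-trans (≤-trans A≤C n∸[a+2]≤n∸1) M≤k))
  ... | false | _       | true  | ofʸ k<C | _     | _       =
    ⊥-elim (<⇒≱ k<C (≤-trans n∸[a+2]≤n∸1 M≤k))
  ... | false | _       | false | _       | true  | ofʸ k<M = ⊥-elim (<⇒≱ k<M M≤k)
  ... | false | _       | false | _       | false | _       = refl

  clsAdj-cW-cls : a ∸ 1 ≤ n ∸ (a + 2) →
    ∀ k → clsAdj cW (cls a n k) ≡ between (n ∸ (a + 2)) (n ∸ 1) k
  clsAdj-cW-cls A≤C k
    with k <ᵇ (a ∸ 1) | <ᵇ-reflects-< k (a ∸ 1) | k <ᵇ (n ∸ (a + 2)) | <ᵇ-reflects-< k (n ∸ (a + 2))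
       | k <ᵇ (n ∸ 1)
  ... | true  | ofʸ k<A | false | ofⁿ k≮C | _     = ⊥-elim (k≮C (<-≤-trans k<A A≤C))
  ... | true  | _       | true  | _       | _     = refl
  ... | false | _       | true  | _       | _     = refl
  ... | false | _       | false | _       | true  = refl
  ... | false | _       | false | _       | false = refl

  clsAdj-cI-cls : ∀ k → clsAdj cI (cls a n k) ≡ not (between (a ∸ 1) (n ∸ 1) k)
  clsAdj-cI-cls k
    with k <ᵇ (a ∸ 1) | k <ᵇ (n ∸ (a + 2)) | <ᵇ-reflects-< k (n ∸ (a + 2))
       | k <ᵇ (n ∸ 1) | <ᵇ-reflects-< k (n ∸ 1)
  ... | true  | _     | _       | _     | _       = refl
  ... | false | true  | ofʸ k<C | false | ofⁿ k≮M = ⊥-elim (k≮M (<-≤-trans k<C n∸[a+2]≤n∸1))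
  ... | false | true  | _       | true  | _       = refl
  ... | false | false | _       | true  | _       = refl
  ... | false | false | _       | false | _       = refl

clsAdj-cW⇒cI : ∀ x → clsAdj cW x ≡ true → x ≡ cI
clsAdj-cW⇒cI cI _ = refl

deg-Gna : ∀ {n} a (v : Fin n) {x} → cls a n (toℕ v) ≡ x → clsAdj x x ≡ false →
  deg (Gna n a) v ≡ count (λ k → clsAdj x (cls a n k)) n
deg-Gna {n} a v refl loopless = trans (countTrue-toℕ n _) (count-punctured n _ loopless)

module _ {a m : ℕ} (1≤a : 1 ≤ a) (a+a≤m : a + a ≤ m) where

  private
    G : Graph (suc m)
    G = Gna (suc m) a

    w : Fin (suc m)
    w = fromℕ m

    C≡m∸[1+a] : suc m ∸ (a + 2) ≡ m ∸ suc a
    C≡m∸[1+a] = cong (suc m ∸_) (+-comm a 2)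

    1+a≤m : suc a ≤ m
    1+a≤m = ≤-trans (+-monoˡ-≤ a 1≤a) a+a≤m

    A≤C : a ∸ 1 ≤ suc m ∸ (a + 2)
    A≤C = subst (a ∸ 1 ≤_) (≡.sym C≡m∸[1+a])
            (m+n≤o⇒m≤o∸n (a ∸ 1) (≤-trans (≤-reflexive A+[1+a]≡a+a) a+a≤m))
      where
      A+[1+a]≡a+a : a ∸ 1 + suc a ≡ a + a
      A+[1+a]≡a+a = trans (≡.sym (+-assoc (a ∸ 1) 1 a)) (cong (_+ a) (m∸n+n≡m 1≤a))

    cls-w : cls a (suc m) (toℕ w) ≡ cW
    cls-w = cls-≥n∸1 a (suc m) A≤C (toℕ w) (≤-reflexive (≡.sym (toℕ-fromℕ m)))

  deg-Gna-last : deg G w ≡ suc a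
  deg-Gna-last = begin
    deg G w                                            ≡⟨ deg-Gna a w cls-w refl ⟩
    count (λ k → clsAdj cW (cls a (suc m) k)) (suc m)  ≡⟨ count-cong (suc m) (clsAdj-cW-cls a (suc m) A≤C) ⟩
    count (between (suc m ∸ (a + 2)) m) (suc m)        ≡⟨ count-between (n∸[a+2]≤n∸1 a (suc m)) (n≤1+n m) ⟩
    m ∸ (suc m ∸ (a + 2))                              ≡⟨ cong (m ∸_) C≡m∸[1+a] ⟩
    m ∸ (m ∸ suc a)                                    ≡⟨ m∸[m∸n]≡n 1+a≤m ⟩
    suc a                                              ∎
    where open ≡.≡-Reasoning

  deg-Gna-neighbour-last : ∀ u → adj G w u ≡ true → deg G u ≡ a
  deg-Gna-neighbour-last u wu = begin
    deg G u                                               ≡⟨ deg-Gna a u cls-u refl ⟩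
    count (λ k → clsAdj cI (cls a (suc m) k)) (suc m)     ≡⟨ count-cong (suc m) (clsAdj-cI-cls a (suc m)) ⟩
    count (λ k → not (between (a ∸ 1) m k)) (suc m)       ≡⟨ count-not (suc m) (between (a ∸ 1) m) ⟩
    suc m ∸ count (between (a ∸ 1) m) (suc m)             ≡⟨ cong (suc m ∸_) (count-between A≤m (n≤1+n m)) ⟩
    suc m ∸ (m ∸ (a ∸ 1))                                 ≡⟨ +-∸-assoc 1 (m∸n≤m m (a ∸ 1)) ⟩
    suc (m ∸ (m ∸ (a ∸ 1)))                               ≡⟨ cong suc (m∸[m∸n]≡n A≤m) ⟩
    suc (a ∸ 1)                                           ≡⟨ suc-pred a {{>-nonZero 1≤a}} ⟩
    a                                                     ∎
    where
    open ≡.≡-Reasoning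
    A≤m : a ∸ 1 ≤ m
    A≤m = ≤-trans A≤C (n∸[a+2]≤n∸1 a (suc m))
    cls-u : cls a (suc m) (toℕ u) ≡ cI
    cls-u = clsAdj-cW⇒cI _ (subst (λ x → clsAdj x (cls a (suc m) (toℕ u)) ≡ true) cls-w
              (∧-conicalʳ _ _ wu))

-- (2 + n) % 2 reduces to n % 2 definitionally.
1+n%2≢n%2 : ∀ n → suc n % 2 ≢ n % 2
1+n%2≢n%2 (suc (suc n)) = 1+n%2≢n%2 n

lemma2p8 : (a b n : ℕ) → 2 ≤ a → a < b → a % 2 ≡ b % 2 → (n * a) % 2 ≡ 0 →
    2 * a + 1 ≤ n → ¬ HasParityFactor a b (Gna n a)
lemma2p8 a b zero    _   _ _ _ 2a+1≤0 with () ← m+n≤o⇒n≤o (2 * a) 2a+1≤0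
lemma2p8 a b (suc m) 2≤a _ _ _ 2a+1≤n =
  no-parity-factor {G = Gna (suc m) a} a b (fromℕ m)
    (λ u wu → ≤-reflexive (deg-Gna-neighbour-last 1≤a a+a≤m u wu))
    (λ parity → 1+n%2≢n%2 a (trans (cong (_% 2) (≡.sym (deg-Gna-last 1≤a a+a≤m))) parity))
  where
  1≤a : 1 ≤ a
  1≤a = ≤-trans (n≤1+n 1) 2≤a
  a+a≤m : a + a ≤ m
  a+a≤m = ≤-pred (subst (_≤ suc m) 2a+1≡1+[a+a] 2a+1≤n)
    where
    2a+1≡1+[a+a] : 2 * a + 1 ≡ suc (a + a)
    2a+1≡1+[a+a] = trans (+-comm (2 * a) 1) (cong (λ t → suc (a + t)) (+-identityʳ a))
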